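{- Let $m=6j-1$ be a prime, where $j$ is a positive integer. For every $r'\in\{0,\pm1,\pm2,\pm(2m-2),\pm(2m+1)\}$ there exist $r\in\{0,\ldots,5\}$, functions $k,\ell_1,\ell_2:\mathbb{Z}\to\mathbb{Z}$ with $6mk'+r'=6k(k')+r$ for all $k'\in\mathbb{Z}_{\ge0}$, and affine linear functions $\psi_\mu:\mathbb{R}^3\to\mathbb{R}^2$, one for each $\mu\in H_r\cup H_{r+6}\cup H_{r+12}$, such that: (a) for every $s\in\mathbb{Z}_{\ge1}$ each restriction $\psi_\mu|_{T_s}$ is injective; (b) for every $k'\in\mathbb{Z}_{\ge0}$ the sets $\psi_\mu(T_{k(k')-i})$, for $i\in\{0,1,2\}$ and $\mu\in H_{r+6i}$, are pairwise disjoint and their union is $R(k')=\mathbb{Z}^2\cap\big([0,\ell_1(k')-1]\times[0,\ell_2(k')-1]\big)$; (c) either $m\mid\ell_1(k')$ for all $k'\ge0$, or $m\mid\ell_2(k')$ for all $k'\ge0$.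
   Context: $V_3$ is the $3\times3$ matrix with columns $v_1=(6,0,0)$, $v_2=(3,3,0)$, $v_3=(2,2,2)$. $F_3=\mathbb{Z}^3\cap\{a v_1+b v_2+c v_3 : a,b\in[0,1),\ c\in(0,1]\}$; for an integer $i$, $H_i=\{\mu\in F_3:\mu_1+\mu_2+\mu_3=i\}$; for an integer $k$, $T_k=\{v\in\mathbb{Z}^3_{\ge0}:v_1+v_2+v_3=k\}$ (empty if $k<0$). -}

module Defs where

open import Data.Nat as ℕ using (ℕ)
open import Data.Integer as ℤ using (ℤ; +_)
open import Data.Rational as ℚ using (ℚ; 0ℚ; 1ℚ)
open import Data.Fin using (Fin; toℕ)
open import Data.Product using (Σ; ∃; _×_; _,_)
open import Data.List using (List; _∷_; [])
open import Relation.Binary.PropositionalEquality using (_≡_)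

ℤ³ : Set
ℤ³ = ℤ × ℤ × ℤ

ℤ² : Set
ℤ² = ℤ × ℤ

-- rational points (the affine maps are taken with rational coefficients)
ℚ³ : Set
ℚ³ = ℚ × ℚ × ℚ

ℚ² : Set
ℚ² = ℚ × ℚ

⟦_⟧ : ℤ → ℚ
⟦ z ⟧ = z ℚ./ 1

⟦_⟧³ : ℤ³ → ℚ³
⟦ x , y , z ⟧³ = ⟦ x ⟧ , ⟦ y ⟧ , ⟦ z ⟧

⟦_⟧² : ℤ² → ℚ²
⟦ x , y ⟧² = ⟦ x ⟧ , ⟦ y ⟧

_·³_ : ℚ → ℚ³ → ℚ³
c ·³ (x , y , z) = c ℚ.* x , c ℚ.* y , c ℚ.* z

_+³_ : ℚ³ → ℚ³ → ℚ³
(x , y , z) +³ (x' , y' , z') = x ℚ.+ x' , y ℚ.+ y' , z ℚ.+ z'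

v₁ v₂ v₃ : ℤ³
v₁ = + 6 , + 0 , + 0
v₂ = + 3 , + 3 , + 0
v₃ = + 2 , + 2 , + 2

-- μ ∈ F₃ : μ ∈ ℤ³ and μ = a v₁ + b v₂ + c v₃ with a, b ∈ [0,1), c ∈ (0,1]
-- (the coefficients are necessarily rational since V₃ is invertible over ℚ)
InF₃ : ℤ³ → Set
InF₃ μ = Σ ℚ λ a → Σ ℚ λ b → Σ ℚ λ c →
  (0ℚ ℚ.≤ a × a ℚ.< 1ℚ) × (0ℚ ℚ.≤ b × b ℚ.< 1ℚ) × (0ℚ ℚ.< c × c ℚ.≤ 1ℚ) ×
  ⟦ μ ⟧³ ≡ ((a ·³ ⟦ v₁ ⟧³) +³ (b ·³ ⟦ v₂ ⟧³)) +³ (c ·³ ⟦ v₃ ⟧³)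

coordSum : ℤ³ → ℤ
coordSum (x , y , z) = (x ℤ.+ y) ℤ.+ z

InH : ℤ → ℤ³ → Set
InH i μ = InF₃ μ × coordSum μ ≡ i

-- v ∈ T_k  (automatically empty for k < 0)
InT : ℤ → ℤ³ → Set
InT k (x , y , z) = (+ 0 ℤ.≤ x) × (+ 0 ℤ.≤ y) × (+ 0 ℤ.≤ z) × ((x ℤ.+ y) ℤ.+ z ≡ k)

record Affine : Set where
  field
    a₁₁ a₁₂ a₁₃ a₂₁ a₂₂ a₂₃ b₁ b₂ : ℚ

apply : Affine → ℚ³ → ℚ²
apply f (x , y , z) =
  ((a₁₁ ℚ.* x ℚ.+ a₁₂ ℚ.* y) ℚ.+ a₁₃ ℚ.* z) ℚ.+ b₁ ,
  ((a₂₁ ℚ.* x ℚ.+ a₂₂ ℚ.* y) ℚ.+ a₂₃ ℚ.* z) ℚ.+ b₂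
  where open Affine f

InR : ℤ → ℤ → ℤ² → Set
InR ℓ₁ ℓ₂ (x , y) =
  (+ 0 ℤ.≤ x × x ℤ.≤ ℓ₁ ℤ.- + 1) × (+ 0 ℤ.≤ y × y ℤ.≤ ℓ₂ ℤ.- + 1)

admissible-r′ : ℕ → List ℤ
admissible-r′ m =
  + 0 ∷ + 1 ∷ ℤ.- + 1 ∷ + 2 ∷ ℤ.- + 2 ∷
  (+ 2 ℤ.* + m ℤ.- + 2) ∷ ℤ.- (+ 2 ℤ.* + m ℤ.- + 2) ∷
  (+ 2 ℤ.* + m ℤ.+ + 1) ∷ ℤ.- (+ 2 ℤ.* + m ℤ.+ + 1) ∷ []

ι : Fin 3 → ℤ
ι i = + toℕ i

-- Every point of F₃ is (d+e+c+1, e+c+1, c+1) with d < 6, e < 3, c < 2, so for each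
-- residue r the levels H_r, H_{r+6}, H_{r+12} together contain exactly six points.  Take
-- ℓ₁ = k + δ and cut the rectangle [0, ℓ₁) × [0, ℓ₂) along its second side into three
-- blocks of sizes ℓ₁ × (ℓ₁ + ε_b) with ε_b ∈ {0, 1, -1}.  The antidiagonal splits each
-- block into a copy of a triangle T_{ℓ₁-κ} in its lower-left corner and a copy of T_{ℓ₁-κ′},
-- rotated by a half turn, in its upper-right corner, where κ + κ′ + ε_b = 3.  For suitable
-- δ and ε_b these six triangles are T_{k-i} with exactly the multiplicities of the six
-- points μ on the levels, so assigning one μ to each triangle tiles the rectangle.  Each
-- placement is affine and independent of k, and ℓ₂ = 3ℓ₁ + Σ ε_b.  Choosing k(k′) = m k′ + q
-- then makes m divide ℓ₁ for r′ ∈ {0, ±1, ±2}, and ℓ₂ for the other four values of r′.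
module Submission where

open import Defs
open import Data.Bool using (if_then_else_)
open import Data.Empty using (⊥; ⊥-elim)
open import Data.Fin as Fin using (Fin; zero; suc; toℕ; fromℕ<; #_)
import Data.Fin.Properties as FinP
open import Data.Integer as ℤ using (ℤ; +_; _+_; _-_; _*_; _≤_; _<_; -_)
open import Data.Integer.Divisibility using (_∣_)
open import Data.Integer.Divisibility.Signed as Signed using (divides; ∣⇒∣ᵤ; ∣-refl; ∣m⇒∣m*n; ∣m∣n⇒∣m+n)
open import Data.Integer.GCD using (gcd; gcd-zeroʳ)
import Data.Integer.Properties as ℤP
open import Algebra.Properties.AbelianGroup ℤP.+-0-abelianGroup using () renaming (∙-cancelˡ to +-cancelˡ)
open import Data.Integer.Tactic.RingSolver
open import Data.List using (List; _∷_; [])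
open import Data.List.Membership.Propositional using (_∈_)
open import Data.List.Relation.Unary.Any using (here; there)
open import Data.Nat as ℕ using (ℕ)
open import Data.Nat.Primality using (Prime)
import Data.Nat.Properties as ℕP
open import Data.Product using (Σ; _×_; _,_; proj₁; proj₂; uncurry)
open import Data.Product.Properties using (≡-dec)
open import Data.Rational as ℚ using (ℚ; mkℚ; 0ℚ; 1ℚ)
import Data.Rational.Properties as ℚP
import Data.Rational.Unnormalised as ℚᵘ
import Data.Rational.Unnormalised.Properties as ℚᵘP
open import Data.Sum as Sum using (_⊎_; inj₁; inj₂)
open import Data.Unit using (tt)
open import Function using (_∘_)
open import Relation.Binary.Definitions using (tri<; tri≈; tri>)
open import Relation.Binary.PropositionalEquality
open import Relation.Nullary.Decidable using (Dec; yes; no; does; map′; toWitness; _×-dec_; _→-dec_)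

-- Integers inside ℚ

i*gcd[j,1]≡i : ∀ i j → i * gcd j (+ 1) ≡ i
i*gcd[j,1]≡i i j = trans (cong (i *_) (gcd-zeroʳ j)) (ℤP.*-identityʳ i)

↥⟦⟧ : ∀ z → ℚ.↥ ⟦ z ⟧ ≡ z
↥⟦⟧ z = trans (sym (i*gcd[j,1]≡i _ z)) (ℚP.↥-/ z 1)

↧⟦⟧ : ∀ z → ℚ.↧ ⟦ z ⟧ ≡ + 1
↧⟦⟧ z = trans (sym (i*gcd[j,1]≡i _ z)) (ℚP.↧-/ z 1)

toℚᵘ-⟦⟧ : ∀ z → ℚ.toℚᵘ ⟦ z ⟧ ≡ ℚᵘ.mkℚᵘ z 0
toℚᵘ-⟦⟧ z with ⟦ z ⟧ | ↥⟦⟧ z | ↧⟦⟧ z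
... | mkℚ _ 0 _ | refl | refl = refl

⟦⟧-injective : ∀ {a b} → ⟦ a ⟧ ≡ ⟦ b ⟧ → a ≡ b
⟦⟧-injective {a} {b} eq = trans (sym (↥⟦⟧ a)) (trans (cong ℚ.↥_ eq) (↥⟦⟧ b))

⟦⟧²-injective : ∀ {p q} → ⟦ p ⟧² ≡ ⟦ q ⟧² → p ≡ q
⟦⟧²-injective {_ , _} {_ , _} eq = cong₂ _,_ (⟦⟧-injective (cong proj₁ eq)) (⟦⟧-injective (cong proj₂ eq))

⟦⟧-homo-* : ∀ a b → ⟦ a ⟧ ℚ.* ⟦ b ⟧ ≡ ⟦ a * b ⟧
⟦⟧-homo-* a b = ℚP.toℚᵘ-injective (begin
  ℚ.toℚᵘ (⟦ a ⟧ ℚ.* ⟦ b ⟧)         ≈⟨ ℚP.toℚᵘ-homo-* ⟦ a ⟧ ⟦ b ⟧ ⟩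
  ℚ.toℚᵘ ⟦ a ⟧ ℚᵘ.* ℚ.toℚᵘ ⟦ b ⟧   ≡⟨ cong₂ ℚᵘ._*_ (toℚᵘ-⟦⟧ a) (toℚᵘ-⟦⟧ b) ⟩
  ℚᵘ.mkℚᵘ (a * b) 0                ≡⟨ sym (toℚᵘ-⟦⟧ (a * b)) ⟩
  ℚ.toℚᵘ ⟦ a * b ⟧                 ∎)
  where open ℚᵘP.≃-Reasoning

⟦⟧-homo-+ : ∀ a b → ⟦ a ⟧ ℚ.+ ⟦ b ⟧ ≡ ⟦ a + b ⟧
⟦⟧-homo-+ a b = ℚP.toℚᵘ-injective (begin
  ℚ.toℚᵘ (⟦ a ⟧ ℚ.+ ⟦ b ⟧)         ≈⟨ ℚP.toℚᵘ-homo-+ ⟦ a ⟧ ⟦ b ⟧ ⟩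
  ℚ.toℚᵘ ⟦ a ⟧ ℚᵘ.+ ℚ.toℚᵘ ⟦ b ⟧   ≡⟨ cong₂ ℚᵘ._+_ (toℚᵘ-⟦⟧ a) (toℚᵘ-⟦⟧ b) ⟩
  ℚᵘ.mkℚᵘ (a * + 1 + b * + 1) 0    ≡⟨ cong (λ n → ℚᵘ.mkℚᵘ n 0) (cong₂ _+_ (ℤP.*-identityʳ a) (ℤP.*-identityʳ b)) ⟩
  ℚᵘ.mkℚᵘ (a + b) 0                ≡⟨ sym (toℚᵘ-⟦⟧ (a + b)) ⟩
  ℚ.toℚᵘ ⟦ a + b ⟧                 ∎)
  where open ℚᵘP.≃-Reasoning

⟦⟧-cancel-≤ : ∀ {a b} → ⟦ a ⟧ ℚ.≤ ⟦ b ⟧ → a ≤ b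
⟦⟧-cancel-≤ {a} {b} p with subst₂ ℚᵘ._≤_ (toℚᵘ-⟦⟧ a) (toℚᵘ-⟦⟧ b) (ℚP.toℚᵘ-mono-≤ p)
... | ℚᵘ.*≤* q = subst₂ _≤_ (ℤP.*-identityʳ a) (ℤP.*-identityʳ b) q

⟦⟧-cancel-< : ∀ {a b} → ⟦ a ⟧ ℚ.< ⟦ b ⟧ → a < b
⟦⟧-cancel-< {a} {b} p with subst₂ ℚᵘ._<_ (toℚᵘ-⟦⟧ a) (toℚᵘ-⟦⟧ b) (ℚP.toℚᵘ-mono-< p)
... | ℚᵘ.*<* q = subst₂ _<_ (ℤP.*-identityʳ a) (ℤP.*-identityʳ b) q

Form : Set
Form = ℤ × ℤ × ℤ × ℤ

eval : Form → ℤ³ → ℤ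
eval (α , β , γ , c) (x , y , z) = ((α * x + β * y) + γ * z) + c

affine : Form → Form → Affine
affine (α , β , γ , c) (α′ , β′ , γ′ , c′) = record
  { a₁₁ = ⟦ α ⟧ ; a₁₂ = ⟦ β ⟧ ; a₁₃ = ⟦ γ ⟧ ; b₁ = ⟦ c ⟧
  ; a₂₁ = ⟦ α′ ⟧ ; a₂₂ = ⟦ β′ ⟧ ; a₂₃ = ⟦ γ′ ⟧ ; b₂ = ⟦ c′ ⟧ }

⟦⟧-eval : ∀ α β γ c x y z →
  ((⟦ α ⟧ ℚ.* ⟦ x ⟧ ℚ.+ ⟦ β ⟧ ℚ.* ⟦ y ⟧) ℚ.+ ⟦ γ ⟧ ℚ.* ⟦ z ⟧) ℚ.+ ⟦ c ⟧ ≡ ⟦ eval (α , β , γ , c) (x , y , z) ⟧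
⟦⟧-eval α β γ c x y z
  rewrite ⟦⟧-homo-* α x | ⟦⟧-homo-* β y | ⟦⟧-homo-* γ z
        | ⟦⟧-homo-+ (α * x) (β * y) | ⟦⟧-homo-+ (α * x + β * y) (γ * z)
        | ⟦⟧-homo-+ ((α * x + β * y) + γ * z) c = refl

apply-affine : ∀ f g u → apply (affine f g) ⟦ u ⟧³ ≡ ⟦ eval f u , eval g u ⟧²
apply-affine (α , β , γ , c) (α′ , β′ , γ′ , c′) (x , y , z) =
  cong₂ _,_ (⟦⟧-eval α β γ c x y z) (⟦⟧-eval α′ β′ γ′ c′ x y z)

-- The fundamental parallelepiped F₃

Digits : Set
Digits = Fin 6 × Fin 3 × Fin 2

point : Digits → ℤ³
point (d , e , c) = + toℕ d + (+ toℕ e + (+ toℕ c + + 1)) , + toℕ e + (+ toℕ c + + 1) , + toℕ c + + 1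

coefficients-of : Digits → ℚ × ℚ × ℚ
coefficients-of (d , e , c) = + toℕ d ℚ./ 6 , + toℕ e ℚ./ 3 , + ℕ.suc (toℕ c) ℚ./ 2

F₃-coefficients : ℤ³ → ℚ × ℚ × ℚ → Set
F₃-coefficients μ (a , b , c) =
  (0ℚ ℚ.≤ a × a ℚ.< 1ℚ) × (0ℚ ℚ.≤ b × b ℚ.< 1ℚ) × (0ℚ ℚ.< c × c ℚ.≤ 1ℚ) ×
  ⟦ μ ⟧³ ≡ ((a ·³ ⟦ v₁ ⟧³) +³ (b ·³ ⟦ v₂ ⟧³)) +³ (c ·³ ⟦ v₃ ⟧³)

F₃-coefficients? : ∀ μ abc → Dec (F₃-coefficients μ abc)
F₃-coefficients? μ (a , b , c) =
  ((0ℚ ℚP.≤? a) ×-dec (a ℚP.<? 1ℚ)) ×-dec ((0ℚ ℚP.≤? b) ×-dec (b ℚP.<? 1ℚ)) ×-dec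
  ((0ℚ ℚP.<? c) ×-dec (c ℚP.≤? 1ℚ)) ×-dec ≡-dec ℚP._≟_ (≡-dec ℚP._≟_ ℚP._≟_) _ _

point-InF₃ : ∀ t → InF₃ (point t)
point-InF₃ (d , e , c) = _ , _ , _ , toWitness {a? = FinP.all? λ d → FinP.all? λ e → FinP.all? λ c →
  F₃-coefficients? (point (d , e , c)) (coefficients-of (d , e , c))} tt d e c

offset-bounds : ∀ (t : ℚ) K {p q} .{{_ : ℚ.Positive ⟦ K ⟧}} → 0ℚ ℚ.≤ t → t ℚ.< 1ℚ →
                ⟦ p ⟧ ≡ t ℚ.* ⟦ K ⟧ ℚ.+ ⟦ q ⟧ → q ≤ p × p < K + q
offset-bounds t K {p} {q} 0≤t t<1 eq = ⟦⟧-cancel-≤ q≤p , ⟦⟧-cancel-< p<K+q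
  where
  open ℚP.≤-Reasoning
  q≤p : ⟦ q ⟧ ℚ.≤ ⟦ p ⟧
  q≤p = begin
    ⟦ q ⟧                    ≡⟨ sym (ℚP.+-identityˡ ⟦ q ⟧) ⟩
    0ℚ ℚ.+ ⟦ q ⟧             ≡⟨ cong (ℚ._+ ⟦ q ⟧) (sym (ℚP.*-zeroˡ ⟦ K ⟧)) ⟩
    0ℚ ℚ.* ⟦ K ⟧ ℚ.+ ⟦ q ⟧   ≤⟨ ℚP.+-monoˡ-≤ ⟦ q ⟧ (ℚP.*-monoʳ-≤-nonNeg ⟦ K ⟧ {{ℚP.pos⇒nonNeg ⟦ K ⟧}} 0≤t) ⟩
    t ℚ.* ⟦ K ⟧ ℚ.+ ⟦ q ⟧    ≡⟨ sym eq ⟩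
    ⟦ p ⟧                    ∎
  p<K+q : ⟦ p ⟧ ℚ.< ⟦ K + q ⟧
  p<K+q = begin-strict
    ⟦ p ⟧                    ≡⟨ eq ⟩
    t ℚ.* ⟦ K ⟧ ℚ.+ ⟦ q ⟧    <⟨ ℚP.+-monoˡ-< ⟦ q ⟧ (ℚP.*-monoˡ-<-pos ⟦ K ⟧ t<1) ⟩
    1ℚ ℚ.* ⟦ K ⟧ ℚ.+ ⟦ q ⟧   ≡⟨ cong (ℚ._+ ⟦ q ⟧) (ℚP.*-identityˡ ⟦ K ⟧) ⟩
    ⟦ K ⟧ ℚ.+ ⟦ q ⟧          ≡⟨ ⟦⟧-homo-+ K q ⟩
    ⟦ K + q ⟧                ∎

positive-bounds : ∀ (t : ℚ) K {p} .{{_ : ℚ.Positive ⟦ K ⟧}} → 0ℚ ℚ.< t → t ℚ.≤ 1ℚ →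
                  ⟦ p ⟧ ≡ t ℚ.* ⟦ K ⟧ → + 0 < p × p ≤ K
positive-bounds t K {p} 0<t t≤1 eq = ⟦⟧-cancel-< 0<p , ⟦⟧-cancel-≤ p≤K
  where
  open ℚP.≤-Reasoning
  0<p : 0ℚ ℚ.< ⟦ p ⟧
  0<p = begin-strict
    0ℚ               ≡⟨ sym (ℚP.*-zeroˡ ⟦ K ⟧) ⟩
    0ℚ ℚ.* ⟦ K ⟧     <⟨ ℚP.*-monoˡ-<-pos ⟦ K ⟧ 0<t ⟩
    t ℚ.* ⟦ K ⟧      ≡⟨ sym eq ⟩
    ⟦ p ⟧            ∎
  p≤K : ⟦ p ⟧ ℚ.≤ ⟦ K ⟧
  p≤K = begin
    ⟦ p ⟧            ≡⟨ eq ⟩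
    t ℚ.* ⟦ K ⟧      ≤⟨ ℚP.*-monoʳ-≤-nonNeg ⟦ K ⟧ {{ℚP.pos⇒nonNeg ⟦ K ⟧}} t≤1 ⟩
    1ℚ ℚ.* ⟦ K ⟧     ≡⟨ ℚP.*-identityˡ ⟦ K ⟧ ⟩
    ⟦ K ⟧            ∎

[i+j]-j≡i : ∀ i j → (i + j) - j ≡ i
[i+j]-j≡i = solve-∀

digit : ∀ {K p q} → q ≤ p × p < + K + q → Σ (Fin K) λ f → p ≡ + toℕ f + q
digit {K} {p} {q} (q≤p , p<K+q) = fromℕ< m<K , (begin
  p                        ≡⟨ solve (p ∷ q ∷ []) ⟩
  (p - q) + q              ≡⟨ cong (_+ q) (sym (ℤP.0≤i⇒+∣i∣≡i 0≤p-q)) ⟩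
  + m + q                  ≡⟨ cong (λ n → + n + q) (sym (FinP.toℕ-fromℕ< m<K)) ⟩
  + toℕ (fromℕ< m<K) + q   ∎)
  where
  open ≡-Reasoning
  0≤p-q = ℤP.i≤j⇒0≤j-i q≤p
  m = ℤ.∣ p - q ∣
  m<K : m ℕ.< K
  m<K = ℤP.drop‿+<+ (subst₂ _<_ (sym (ℤP.0≤i⇒+∣i∣≡i 0≤p-q)) ([i+j]-j≡i (+ K) q) (ℤP.+-monoˡ-< (- q) p<K+q))

≡-point : ∀ {x y z} {d e c} → x ≡ + toℕ d + y → y ≡ + toℕ e + z → z ≡ + toℕ c + + 1 → (x , y , z) ≡ point (d , e , c)
≡-point refl refl refl = refl

InF₃⇒point : ∀ μ → InF₃ μ → Σ Digits λ t → μ ≡ point t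
InF₃⇒point (x , y , z) (a , b , c , (0≤a , a<1) , (0≤b , b<1) , (0<c , c≤1) , eq) =
  (proj₁ dx , proj₁ dy , proj₁ dz) , ≡-point {d = proj₁ dx} {proj₁ dy} {proj₁ dz} (proj₂ dx) (proj₂ dy) (proj₂ dz)
  where
  ⟦z⟧≡ : ⟦ z ⟧ ≡ c ℚ.* ⟦ + 2 ⟧
  ⟦z⟧≡ = trans (cong (proj₂ ∘ proj₂) eq)
    (trans (cong₂ (λ u v → (u ℚ.+ v) ℚ.+ c ℚ.* ⟦ + 2 ⟧) (ℚP.*-zeroʳ a) (ℚP.*-zeroʳ b)) (ℚP.+-identityˡ (c ℚ.* ⟦ + 2 ⟧)))
  ⟦y⟧≡ : ⟦ y ⟧ ≡ b ℚ.* ⟦ + 3 ⟧ ℚ.+ ⟦ z ⟧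
  ⟦y⟧≡ = trans (cong (proj₁ ∘ proj₂) eq)
    (cong₂ ℚ._+_ (trans (cong (ℚ._+ b ℚ.* ⟦ + 3 ⟧) (ℚP.*-zeroʳ a)) (ℚP.+-identityˡ (b ℚ.* ⟦ + 3 ⟧))) (sym ⟦z⟧≡))
  ⟦x⟧≡ : ⟦ x ⟧ ≡ a ℚ.* ⟦ + 6 ⟧ ℚ.+ ⟦ y ⟧
  ⟦x⟧≡ = trans (cong proj₁ eq)
    (trans (ℚP.+-assoc (a ℚ.* ⟦ + 6 ⟧) (b ℚ.* ⟦ + 3 ⟧) (c ℚ.* ⟦ + 2 ⟧))
      (cong (a ℚ.* ⟦ + 6 ⟧ ℚ.+_) (trans (cong (b ℚ.* ⟦ + 3 ⟧ ℚ.+_) (sym ⟦z⟧≡)) (sym ⟦y⟧≡))))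
  dx : Σ (Fin 6) λ d → x ≡ + toℕ d + y
  dx = digit (offset-bounds a (+ 6) {x} {y} 0≤a a<1 ⟦x⟧≡)
  dy : Σ (Fin 3) λ e → y ≡ + toℕ e + z
  dy = digit (offset-bounds b (+ 3) {y} {z} 0≤b b<1 ⟦y⟧≡)
  dz : Σ (Fin 2) λ c′ → z ≡ + toℕ c′ + + 1
  dz = let (0<z , z≤2) = positive-bounds c (+ 2) {z} 0<c c≤1 ⟦z⟧≡ in
    digit (ℤP.i<j⇒suc[i]≤j 0<z , ℤP.≤-<-trans z≤2 (ℤ.+<+ (ℕ.s≤s (ℕ.s≤s (ℕ.s≤s ℕ.z≤n)))))

-- Triangles and blocks

≤-by : ∀ {a b} c → + 0 ≤ c → a + c ≡ b → a ≤ b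
≤-by {a} c 0≤c refl = ℤP.≤-trans (ℤP.≤-reflexive (sym (ℤP.+-identityʳ a))) (ℤP.+-monoʳ-≤ a 0≤c)

<-by : ∀ {a b} c → + 0 ≤ c → (a + + 1) + c ≡ b → a < b
<-by {a} c 0≤c eq = ℤP.suc[i]≤j⇒i<j (≤-by c 0≤c (trans (cong (_+ c) (ℤP.+-comm (+ 1) a)) eq))

0≤+ : ∀ {a b} → + 0 ≤ a → + 0 ≤ b → + 0 ≤ a + b
0≤+ = ℤP.+-mono-≤

≤-pred⇒< : ∀ {a b} → a ≤ b - + 1 → a < b
≤-pred⇒< {a} {b} a≤ = ℤP.i≤pred[j]⇒i<j (subst (a ≤_) (ℤP.+-comm b (- + 1)) a≤)

<⇒≤-pred : ∀ {a b} → a < b → a ≤ b - + 1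
<⇒≤-pred {a} {b} a<b = subst (a ≤_) (ℤP.+-comm (- + 1) b) (ℤP.i<j⇒i≤pred[j] a<b)

0≤p≤h-1⇒1≤h : ∀ {h p} → + 0 ≤ p × p ≤ h - + 1 → + 1 ≤ h
0≤p≤h-1⇒1≤h (0≤p , p≤) = ℤP.0≤i-j⇒j≤i (ℤP.≤-trans 0≤p p≤)

i≡j-k⇒j≡i+k : ∀ j k {i} → i ≡ j - k → j ≡ i + k
i≡j-k⇒j≡i+k j k refl = solve (j ∷ k ∷ [])

i+[j-i]≡j : ∀ i j → i + (j - i) ≡ j
i+[j-i]≡j = solve-∀

[i+j-1]-i≡j-1 : ∀ i j → ((i + j) - + 1) - i ≡ j - + 1
[i+j-1]-i≡j-1 = solve-∀

minus-injective : ∀ a {x y} → a - x ≡ a - y → x ≡ y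
minus-injective a {x} {y} eq = ℤP.neg-injective (+-cancelˡ a (- x) (- y) eq)

∑ : ℤ² → ℤ
∑ (p , q) = p + q

xy : ℤ³ → ℤ²
xy (x , y , _) = x , y

InT-unique : ∀ {t u v} → InT t u → InT t v → xy u ≡ xy v → u ≡ v
InT-unique {u = x , y , z} {v = .x , .y , z′} (_ , _ , _ , refl) (_ , _ , _ , e′) refl =
  cong (λ z → x , y , z) (+-cancelˡ (x + y) z z′ (sym e′))

-- The block is InR h (h + ε).  The lower triangle T_{h-κˡ} sits in its corner (0, 0) and the
-- upper one T_{h-κᵘ}, rotated by a half turn, in the opposite corner; both fit inside the
-- block when these four quantities are nonnegative.
record Fits (ε κˡ : ℤ) : Set where
  field
    κˡ≥1 : + 0 ≤ κˡ - + 1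
    κˡ+ε≥1 : + 0 ≤ (κˡ + ε) - + 1
    κᵘ≥1 : + 0 ≤ ((+ 3 - κˡ) - ε) - + 1
    κᵘ+ε≥1 : + 0 ≤ (((+ 3 - κˡ) - ε) + ε) - + 1

module Block {ε κˡ : ℤ} (fits : Fits ε κˡ) where
  open Fits fits

  -- κˡ + κᵘ + ε = 3 is what makes the two triangles complementary in the block.  Inside
  -- proofs κᵘ is written out, since the ring solver treats a defined name as a constant.
  κᵘ : ℤ
  κᵘ = (+ 3 - κˡ) - ε

  upper : ℤ → ℤ³ → ℤ²
  upper h (x , y , _) = (h - + 1) - x , ((h + ε) - + 1) - y

  lower∈block : ∀ h u → InT (h - κˡ) u → InR h (h + ε) (xy u) × ∑ (xy u) ≤ h - κˡ
  lower∈block h (x , y , z) (0≤x , 0≤y , 0≤z , e) with i≡j-k⇒j≡i+k h κˡ e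
  ... | refl =
    ((0≤x , ≤-by ((y + z) + (κˡ - + 1)) (0≤+ (0≤+ 0≤y 0≤z) κˡ≥1) (solve (x ∷ y ∷ z ∷ κˡ ∷ []))) ,
     (0≤y , ≤-by ((x + z) + ((κˡ + ε) - + 1)) (0≤+ (0≤+ 0≤x 0≤z) κˡ+ε≥1) (solve (x ∷ y ∷ z ∷ κˡ ∷ ε ∷ [])))) ,
    ≤-by z 0≤z (solve (x ∷ y ∷ z ∷ κˡ ∷ []))

  upper∈block : ∀ h u → InT (h - κᵘ) u → InR h (h + ε) (upper h u) × h - κˡ < ∑ (upper h u)
  upper∈block h (x , y , z) (0≤x , 0≤y , 0≤z , e) with i≡j-k⇒j≡i+k h ((+ 3 - κˡ) - ε) e
  ... | refl =
    ((≤-by ((y + z) + (((+ 3 - κˡ) - ε) - + 1)) (0≤+ (0≤+ 0≤y 0≤z) κᵘ≥1) (solve (x ∷ y ∷ z ∷ κˡ ∷ ε ∷ [])) ,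
      ≤-by x 0≤x (solve (x ∷ y ∷ z ∷ κˡ ∷ ε ∷ []))) ,
     (≤-by ((x + z) + ((((+ 3 - κˡ) - ε) + ε) - + 1)) (0≤+ (0≤+ 0≤x 0≤z) κᵘ+ε≥1) (solve (x ∷ y ∷ z ∷ κˡ ∷ ε ∷ [])) ,
      ≤-by y 0≤y (solve (x ∷ y ∷ z ∷ κˡ ∷ ε ∷ [])))) ,
    <-by z 0≤z (solve (x ∷ y ∷ z ∷ κˡ ∷ ε ∷ []))

  block-split : ∀ h p → InR h (h + ε) p →
    (Σ ℤ³ λ u → InT (h - κˡ) u × xy u ≡ p) ⊎ (Σ ℤ³ λ u → InT (h - κᵘ) u × upper h u ≡ p)
  block-split h (p , q) ((0≤p , p≤h-1) , (0≤q , q≤h+ε-1)) with p + q ℤP.≤? h - κˡ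
  ... | yes p+q≤ = inj₁ ((p , q , (h - κˡ) - (p + q)) ,
          (0≤p , 0≤q , ℤP.i≤j⇒0≤j-i p+q≤ , solve (p ∷ q ∷ h ∷ κˡ ∷ [])) , refl)
  ... | no p+q≰ = inj₂ (((h - + 1) - p , ((h + ε) - + 1) - q , (p + q) - ((h - κˡ) + + 1)) ,
          (ℤP.i≤j⇒0≤j-i p≤h-1 , ℤP.i≤j⇒0≤j-i q≤h+ε-1 , ℤP.i≤j⇒0≤j-i h-κˡ<p+q , sum≡) ,
          cong₂ _,_ (solve (p ∷ h ∷ [])) (solve (q ∷ h ∷ ε ∷ [])))
    where
    open ≡-Reasoning
    h-κˡ<p+q : (h - κˡ) + + 1 ≤ p + q
    h-κˡ<p+q = subst (_≤ p + q) (ℤP.+-comm (+ 1) (h - κˡ)) (ℤP.i<j⇒suc[i]≤j (ℤP.≰⇒> p+q≰))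
    sum≡ : (((h - + 1) - p) + (((h + ε) - + 1) - q)) + ((p + q) - ((h - κˡ) + + 1)) ≡ h - κᵘ
    sum≡ = begin
      (((h - + 1) - p) + (((h + ε) - + 1) - q)) + ((p + q) - ((h - κˡ) + + 1))
        ≡⟨ solve (p ∷ q ∷ h ∷ κˡ ∷ ε ∷ []) ⟩
      h - ((+ 3 - κˡ) - ε) ∎

-- Three stacked blocks

-- A block of height h has width h + excess and its lower triangle is T_{h - cut}.
data Shape : Set where
  square wide narrow : Shape

excess : Shape → ℤ
excess square = + 0
excess wide = + 1
excess narrow = - + 1

cut : Shape → ℤ
cut square = + 1
cut wide = + 1
cut narrow = + 2

fits : ∀ σ → Fits (excess σ) (cut σ)
fits square = record { κˡ≥1 = ℤ.+≤+ ℕ.z≤n ; κˡ+ε≥1 = ℤ.+≤+ ℕ.z≤n ; κᵘ≥1 = ℤ.+≤+ ℕ.z≤n ; κᵘ+ε≥1 = ℤ.+≤+ ℕ.z≤n }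
fits wide = record { κˡ≥1 = ℤ.+≤+ ℕ.z≤n ; κˡ+ε≥1 = ℤ.+≤+ ℕ.z≤n ; κᵘ≥1 = ℤ.+≤+ ℕ.z≤n ; κᵘ+ε≥1 = ℤ.+≤+ ℕ.z≤n }
fits narrow = record { κˡ≥1 = ℤ.+≤+ ℕ.z≤n ; κˡ+ε≥1 = ℤ.+≤+ ℕ.z≤n ; κᵘ≥1 = ℤ.+≤+ ℕ.z≤n ; κᵘ+ε≥1 = ℤ.+≤+ ℕ.z≤n }

data Side : Set where
  below above : Side

Slot : Set
Slot = Fin 3 × Side

Interval : ℤ → ℤ → ℤ → Set
Interval lo w c = lo ≤ c × c ≤ (lo + w) - + 1

intervals-disjoint : ∀ {lo w lo′ w′ c} → lo + w ≤ lo′ → Interval lo w c → Interval lo′ w′ c → ⊥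
intervals-disjoint ≤lo′ (_ , c≤) (lo′≤ , _) =
  ℤP.<-irrefl refl (ℤP.<-≤-trans (≤-pred⇒< c≤) (ℤP.≤-trans ≤lo′ lo′≤))

interval⇒offset : ∀ {lo w c} → Interval lo w c → + 0 ≤ c - lo × c - lo ≤ w - + 1
interval⇒offset {lo} {w} {c} (lo≤c , c≤) =
  ℤP.i≤j⇒0≤j-i lo≤c , subst (c - lo ≤_) ([i+j-1]-i≡j-1 lo w) (ℤP.+-monoˡ-≤ (- lo) c≤)

-- The placements of a triangle in block number B, whose offset is B h + E.  On T_{h-κ} the height is
-- h = x + y + z + κ, so the h-dependent placement is the restriction of an affine map that
-- does not depend on h.
below-forms : ℤ → ℤ → ℤ → Form × Form
below-forms B κ E = (+ 1 , + 0 , + 0 , + 0) , (B , B + + 1 , B , B * κ + E)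

above-forms : ℤ → ℤ → ℤ → ℤ → Form × Form
above-forms B κ E ε =
  (+ 0 , + 1 , + 1 , κ - + 1) , (B + + 1 , B , B + + 1 , ((B + + 1) * κ + E) + (ε - + 1))

eval-below-forms : ∀ B κ E x y z → let h = ((x + y) + z) + κ in
  (eval (proj₁ (below-forms B κ E)) (x , y , z) , eval (proj₂ (below-forms B κ E)) (x , y , z)) ≡
  (x , (B * h + E) + y)
eval-below-forms B κ E x y z = cong₂ _,_ (first x y z) (second B κ E x y z)
  where
  first : ∀ x y z → ((+ 1 * x + + 0 * y) + + 0 * z) + + 0 ≡ x
  first = solve-∀
  second : ∀ B κ E x y z → ((B * x + (B + + 1) * y) + B * z) + (B * κ + E) ≡ (B * (((x + y) + z) + κ) + E) + y
  second = solve-∀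

eval-above-forms : ∀ B κ E ε x y z → let h = ((x + y) + z) + κ in
  (eval (proj₁ (above-forms B κ E ε)) (x , y , z) , eval (proj₂ (above-forms B κ E ε)) (x , y , z)) ≡
  ((h - + 1) - x , (B * h + E) + (((h + ε) - + 1) - y))
eval-above-forms B κ E ε x y z = cong₂ _,_ (first κ x y z) (second B κ E ε x y z)
  where
  first : ∀ κ x y z → ((+ 0 * x + + 1 * y) + + 1 * z) + (κ - + 1) ≡ ((((x + y) + z) + κ) - + 1) - x
  first = solve-∀
  second : ∀ B κ E ε x y z → (((B + + 1) * x + B * y) + (B + + 1) * z) + (((B + + 1) * κ + E) + (ε - + 1)) ≡
           (B * (((x + y) + z) + κ) + E) + (((((x + y) + z) + κ + ε) - + 1) - y)
  second = solve-∀

module Stack (shape : Fin 3 → Shape) where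

  width : ℤ → Fin 3 → ℤ
  width h b = h + excess (shape b)

  offset : ℤ → Fin 3 → ℤ
  offset h zero = + 0
  offset h (suc zero) = width h zero
  offset h (suc (suc zero)) = width h zero + width h (suc zero)

  length : ℤ → ℤ
  length h = offset h (suc (suc zero)) + width h (suc (suc zero))

  κ : Slot → ℤ
  κ (b , below) = cut (shape b)
  κ (b , above) = Block.κᵘ (fits (shape b))

  local : ℤ → Slot → ℤ³ → ℤ²
  local h (b , below) u = xy u
  local h (b , above) u = Block.upper (fits (shape b)) h u

  place : ℤ → Slot → ℤ³ → ℤ²
  place h s u = proj₁ (local h s u) , offset h (proj₁ s) + proj₂ (local h s u)

  Separated : ℤ → Slot → ℤ² → Set
  Separated h (b , below) p = ∑ p ≤ h - cut (shape b)
  Separated h (b , above) p = h - cut (shape b) < ∑ p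

  local∈block : ∀ h s u → InT (h - κ s) u →
                InR h (width h (proj₁ s)) (local h s u) × Separated h s (local h s u)
  local∈block h (b , below) = Block.lower∈block (fits (shape b)) h
  local∈block h (b , above) = Block.upper∈block (fits (shape b)) h

  width≥0 : ∀ {h} → + 1 ≤ h → ∀ b → + 0 ≤ width h b
  width≥0 {h} 1≤h b with shape b
  ... | square = ℤP.≤-trans (ℤ.+≤+ ℕ.z≤n) (subst (+ 1 ≤_) (sym (ℤP.+-identityʳ h)) 1≤h)
  ... | wide = ℤP.≤-trans (ℤ.+≤+ ℕ.z≤n) (ℤP.≤-trans 1≤h (ℤP.i≤i+j h (+ 1)))
  ... | narrow = ℤP.i≤j⇒0≤j-i 1≤h

  offsets-ordered : ∀ {h} → + 1 ≤ h → ∀ {b b′} → b Fin.< b′ → offset h b + width h b ≤ offset h b′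
  offsets-ordered 1≤h {zero} {suc zero} _ = ℤP.≤-reflexive (ℤP.+-identityˡ _)
  offsets-ordered {h} 1≤h {zero} {suc (suc zero)} _ =
    ≤-by (width h (suc zero)) (width≥0 1≤h (suc zero)) (cong (_+ width h (suc zero)) (ℤP.+-identityˡ (width h zero)))
  offsets-ordered 1≤h {suc zero} {suc (suc zero)} _ = ℤP.≤-refl
  offsets-ordered 1≤h {suc zero} {suc zero} (ℕ.s≤s ())
  offsets-ordered 1≤h {suc (suc zero)} {suc (suc zero)} (ℕ.s≤s (ℕ.s≤s ()))

  block-unique : ∀ {h} → + 1 ≤ h → ∀ {b b′ c} →
    Interval (offset h b) (width h b) c → Interval (offset h b′) (width h b′) c → b ≡ b′
  block-unique 1≤h {b} {b′} c∈b c∈b′ with FinP.<-cmp b b′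
  ... | tri< b<b′ _ _ = ⊥-elim (intervals-disjoint (offsets-ordered 1≤h b<b′) c∈b c∈b′)
  ... | tri≈ _ b≡b′ _ = b≡b′
  ... | tri> _ _ b′<b = ⊥-elim (intervals-disjoint (offsets-ordered 1≤h b′<b) c∈b′ c∈b)

  block-within : ∀ {h} → + 1 ≤ h → ∀ b → + 0 ≤ offset h b × offset h b + width h b ≤ length h
  block-within {h} 1≤h zero = ℤP.≤-refl ,
    ≤-by (width h (suc zero) + width h (suc (suc zero))) (0≤+ (width≥0 1≤h (suc zero)) (width≥0 1≤h (suc (suc zero))))
      (trans (cong (_+ (width h (suc zero) + width h (suc (suc zero)))) (ℤP.+-identityˡ (width h zero)))
        (sym (ℤP.+-assoc (width h zero) (width h (suc zero)) (width h (suc (suc zero))))))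
  block-within {h} 1≤h (suc zero) = width≥0 1≤h zero ,
    ≤-by (width h (suc (suc zero))) (width≥0 1≤h (suc (suc zero))) refl
  block-within {h} 1≤h (suc (suc zero)) = 0≤+ (width≥0 1≤h zero) (width≥0 1≤h (suc zero)) , ℤP.≤-refl

  shift-into-interval : ∀ o w {q} → + 0 ≤ q → q ≤ w - + 1 → Interval o w (o + q)
  shift-into-interval o w {q} 0≤q q≤ =
    ≤-by q 0≤q refl , subst (o + q ≤_) (sym (ℤP.+-assoc o w (- + 1))) (ℤP.+-monoʳ-≤ o q≤)

  place∈rectangle : ∀ h s u → InT (h - κ s) u → InR h (length h) (place h s u)
  place∈rectangle h s@(b , _) u u∈T with local∈block h s u u∈T
  ... | (p∈ , (0≤q , q≤)) , _ = p∈ , (0≤+ (proj₁ within) 0≤q ,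
          ℤP.≤-trans (proj₂ (shift-into-interval (offset h b) (width h b) 0≤q q≤)) (ℤP.+-monoˡ-≤ (- + 1) (proj₂ within)))
    where within = block-within (0≤p≤h-1⇒1≤h p∈) b

  side-unique : ∀ h b σ σ′ {p} → Separated h (b , σ) p → Separated h (b , σ′) p → σ ≡ σ′
  side-unique h b below below _ _ = refl
  side-unique h b above above _ _ = refl
  side-unique h b below above p≤ <p = ⊥-elim (ℤP.<⇒≱ <p p≤)
  side-unique h b above below <p p≤ = ⊥-elim (ℤP.<⇒≱ <p p≤)

  place-slot-unique : ∀ h s s′ u u′ → InT (h - κ s) u → InT (h - κ s′) u′ →
                      place h s u ≡ place h s′ u′ → s ≡ s′
  place-slot-unique h (b , σ) (b′ , σ′) u u′ u∈T u′∈T eq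
    with local∈block h (b , σ) u u∈T | local∈block h (b′ , σ′) u′ u′∈T
  ... | (p∈ , (0≤q , q≤)) , sep | (_ , (0≤q′ , q′≤)) , sep′
    with block-unique (0≤p≤h-1⇒1≤h p∈) {b} {b′} (shift-into-interval (offset h b) (width h b) 0≤q q≤)
           (subst (Interval (offset h b′) (width h b′)) (sym (cong proj₂ eq))
             (shift-into-interval (offset h b′) (width h b′) 0≤q′ q′≤))
  ... | refl = cong (b ,_) (side-unique h b σ σ′ sep (subst (Separated h (b , σ′)) (sym local≡) sep′))
    where
    local≡ : local h (b , σ) u ≡ local h (b , σ′) u′
    local≡ = cong₂ _,_ (cong proj₁ eq) (+-cancelˡ (offset h b) _ _ (cong proj₂ eq))

  find-block : ∀ {h q} → + 0 ≤ q → q ≤ length h - + 1 → Σ (Fin 3) λ b → Interval (offset h b) (width h b) q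
  find-block {h} {q} 0≤q q≤ with q ℤP.<? offset h (suc zero)
  ... | yes q<o₁ = zero , 0≤q , subst (λ w → q ≤ w - + 1) (sym (ℤP.+-identityˡ (width h zero))) (<⇒≤-pred q<o₁)
  ... | no q≮o₁ with q ℤP.<? offset h (suc (suc zero))
  ...   | yes q<o₂ = suc zero , ℤP.≮⇒≥ q≮o₁ , <⇒≤-pred q<o₂
  ...   | no q≮o₂ = suc (suc zero) , ℤP.≮⇒≥ q≮o₂ , q≤

  place-from-local : ∀ h s u {p q} → local h s u ≡ (p , q - offset h (proj₁ s)) → place h s u ≡ (p , q)
  place-from-local h s u {q = q} eq = cong₂ _,_ (cong proj₁ eq)
    (trans (cong (λ t → offset h (proj₁ s) + t) (cong proj₂ eq)) (i+[j-i]≡j (offset h (proj₁ s)) q))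

  place-cover : ∀ h p → InR h (length h) p → Σ Slot λ s → Σ ℤ³ λ u → InT (h - κ s) u × place h s u ≡ p
  place-cover h (p , q) (p∈ , (0≤q , q≤)) with find-block 0≤q q≤
  ... | b , q∈b with Block.block-split (fits (shape b)) h (p , q - offset h b) (p∈ , interval⇒offset q∈b)
  ...   | inj₁ (u , u∈T , local≡) = (b , below) , u , u∈T , place-from-local h (b , below) u local≡
  ...   | inj₂ (u , u∈T , local≡) = (b , above) , u , u∈T , place-from-local h (b , above) u local≡

  prefix : Fin 3 → ℤ
  prefix zero = + 0
  prefix (suc zero) = excess (shape zero)
  prefix (suc (suc zero)) = excess (shape zero) + excess (shape (suc zero))

  offset-linear : ∀ h b → offset h b ≡ + toℕ b * h + prefix b
  offset-linear h zero = sym (ℤP.*-zeroˡ h)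
  offset-linear h (suc zero) = cong (_+ excess (shape zero)) (sym (ℤP.*-identityˡ h))
  offset-linear h (suc (suc zero)) = twice h (excess (shape zero)) (excess (shape (suc zero)))
    where
    twice : ∀ h e₀ e₁ → (h + e₀) + (h + e₁) ≡ + 2 * h + (e₀ + e₁)
    twice = solve-∀

  total-excess : ℤ
  total-excess = (excess (shape zero) + excess (shape (suc zero))) + excess (shape (suc (suc zero)))

  length-linear : ∀ h → length h ≡ + 3 * h + total-excess
  length-linear h = thrice h (excess (shape zero)) (excess (shape (suc zero))) (excess (shape (suc (suc zero))))
    where
    thrice : ∀ h e₀ e₁ e₂ → ((h + e₀) + (h + e₁)) + (h + e₂) ≡ + 3 * h + ((e₀ + e₁) + e₂)
    thrice = solve-∀

  forms : Slot → Form × Form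
  forms (b , below) = below-forms (+ toℕ b) (κ (b , below)) (prefix b)
  forms (b , above) = above-forms (+ toℕ b) (κ (b , above)) (prefix b) (excess (shape b))

  slot-map : Slot → Affine
  slot-map s = affine (proj₁ (forms s)) (proj₂ (forms s))

  slot-map-agrees : ∀ h s u → InT (h - κ s) u → apply (slot-map s) ⟦ u ⟧³ ≡ ⟦ place h s u ⟧²
  slot-map-agrees h s (x , y , z) (_ , _ , _ , e) with i≡j-k⇒j≡i+k h (κ s) e
  slot-map-agrees _ s@(b , below) u@(x , y , z) _ | refl =
    trans (apply-affine (proj₁ (forms s)) (proj₂ (forms s)) u) (cong ⟦_⟧²
      (trans (eval-below-forms (+ toℕ b) (κ s) (prefix b) x y z)
        (cong (λ o → x , o + y) (sym (offset-linear (((x + y) + z) + κ s) b)))))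
  slot-map-agrees _ s@(b , above) u@(x , y , z) _ | refl =
    trans (apply-affine (proj₁ (forms s)) (proj₂ (forms s)) u) (cong ⟦_⟧²
      (trans (eval-above-forms (+ toℕ b) (κ s) (prefix b) (excess (shape b)) x y z)
        (cong (λ o → ((h - + 1) - x) , o + (((h + excess (shape b)) - + 1) - y)) (sym (offset-linear h b)))))
    where h = ((x + y) + z) + κ s

  place-injective : ∀ h s {u v} → place h s u ≡ place h s v → xy u ≡ xy v
  place-injective h (b , below) eq =
    cong₂ _,_ (cong proj₁ eq) (+-cancelˡ (offset h b) _ _ (cong proj₂ eq))
  place-injective h (b , above) {_ , _ , _} {_ , _ , _} eq =
    cong₂ _,_ (minus-injective (h - + 1) (cong proj₁ eq))
              (minus-injective ((h + excess (shape b)) - + 1) (+-cancelˡ (offset h b) _ _ (cong proj₂ eq)))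

  slot-map-injective : ∀ t s {u v} → InT t u → InT t v →
                       apply (slot-map s) ⟦ u ⟧³ ≡ apply (slot-map s) ⟦ v ⟧³ → u ≡ v
  slot-map-injective t s {u} {v} u∈T v∈T eq = InT-unique u∈T v∈T (place-injective h s (⟦⟧²-injective
    (trans (sym (slot-map-agrees h s u (raise u∈T))) (trans eq (slot-map-agrees h s v (raise v∈T))))))
    where
    h = t + κ s
    raise : ∀ {w} → InT t w → InT (h - κ s) w
    raise {w} = subst (λ t′ → InT t′ w) (sym ([i+j]-j≡i t (κ s)))

-- Layouts

-- ℓ₁ = k + shift, and slot s receives the layer T_{k - level s} of the point label s, which
-- lies in H_{r + 6 level s}.
record Layout : Set where
  field
    shape : Fin 3 → Shape
    shift : ℤ
    level : Slot → Fin 3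
    label : Slot → Digits

_≟³_ : (μ ν : ℤ³) → Dec (μ ≡ ν)
_≟³_ = ≡-dec ℤ._≟_ (≡-dec ℤ._≟_ ℤ._≟_)

_≟ᵈ_ : (t t′ : Digits) → Dec (t ≡ t′)
_≟ᵈ_ = ≡-dec FinP._≟_ (≡-dec FinP._≟_ FinP._≟_)

_≟ˢ_ : (s s′ : Slot) → Dec (s ≡ s′)
(b , σ) ≟ˢ (b′ , σ′) = map′ (uncurry (cong₂ _,_)) (λ { refl → refl , refl }) ((b FinP.≟ b′) ×-dec side≟ σ σ′)
  where
  side≟ : (σ σ′ : Side) → Dec (σ ≡ σ′)
  side≟ below below = yes refl
  side≟ above above = yes refl
  side≟ below above = no λ ()
  side≟ above below = no λ ()

slots : List Slot
slots = (zero , below) ∷ (zero , above) ∷ (suc zero , below) ∷ (suc zero , above) ∷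
        (suc (suc zero) , below) ∷ (suc (suc zero) , above) ∷ []

-- The first slot labelled by μ; a μ that labels no slot gets the junk value (zero , below).
decode : (Slot → Digits) → ℤ³ → Slot
decode label μ = search slots
  where
  search : List Slot → Slot
  search [] = zero , below
  search (s ∷ ss) = if does (point (label s) ≟³ μ) then s else search ss

Target : ℕ → Fin 3 → ℤ
Target r i = + r + + 6 * ι i

record Valid (r : ℕ) (L : Layout) : Set where
  open Layout L
  field
    r<6 : r ℕ.< 6
    κ-level : ∀ s → Stack.κ shape s ≡ shift + ι (level s)
    label-sum : ∀ s → coordSum (point (label s)) ≡ Target r (level s)
    decode-label : ∀ s → decode label (point (label s)) ≡ s
    label-decode : ∀ t i → coordSum (point t) ≡ Target r i →
                   label (decode label (point t)) ≡ t × level (decode label (point t)) ≡ i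

all-slots? : ∀ {P : Slot → Set} → (∀ s → Dec (P s)) → Dec (∀ s → P s)
all-slots? P? = map′ (λ f → λ { (b , below) → proj₁ (f b) ; (b , above) → proj₂ (f b) })
  (λ f b → f (b , below) , f (b , above)) (FinP.all? λ b → P? (b , below) ×-dec P? (b , above))

all-digits? : ∀ {P : Digits → Set} → (∀ t → Dec (P t)) → Dec (∀ t → P t)
all-digits? P? = map′ (λ f → λ { (d , e , c) → f d e c }) (λ f d e c → f (d , e , c))
  (FinP.all? λ d → FinP.all? λ e → FinP.all? λ c → P? (d , e , c))

valid? : ∀ r L → Dec (Valid r L)
valid? r L = map′
  (λ (r<6 , κ-level , label-sum , decode-label , label-decode) → record
     { r<6 = r<6 ; κ-level = κ-level ; label-sum = label-sum
     ; decode-label = decode-label ; label-decode = label-decode })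
  (λ v → let open Valid v in r<6 , κ-level , label-sum , decode-label , label-decode)
  ((r ℕ.<? 6) ×-dec
   all-slots? (λ s → Stack.κ shape s ℤ.≟ shift + ι (level s)) ×-dec
   all-slots? (λ s → coordSum (point (label s)) ℤ.≟ Target r (level s)) ×-dec
   all-slots? (λ s → decode label (point (label s)) ≟ˢ s) ×-dec
   all-digits? λ t → FinP.all? λ i → (coordSum (point t) ℤ.≟ Target r i) →-dec
     ((label (decode label (point t)) ≟ᵈ t) ×-dec (level (decode label (point t)) FinP.≟ i)))
  where open Layout L

InjectiveOnLayers : ℕ → (ℤ³ → Affine) → Set
InjectiveOnLayers r ψ = (s : ℤ) → + 1 ≤ s → (i : Fin 3) → (μ : ℤ³) → InH (Target r i) μ →
  (u v : ℤ³) → InT s u → InT s v → apply (ψ μ) ⟦ u ⟧³ ≡ apply (ψ μ) ⟦ v ⟧³ → u ≡ v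

DisjointImages : ℕ → (ℤ³ → Affine) → ℤ → Set
DisjointImages r ψ k = (i i′ : Fin 3) → (μ μ′ : ℤ³) → InH (Target r i) μ → InH (Target r i′) μ′ →
  (u u′ : ℤ³) → InT (k - ι i) u → InT (k - ι i′) u′ →
  apply (ψ μ) ⟦ u ⟧³ ≡ apply (ψ μ′) ⟦ u′ ⟧³ → i ≡ i′ × μ ≡ μ′

ImagesInside : ℕ → (ℤ³ → Affine) → ℤ → ℤ → ℤ → Set
ImagesInside r ψ k ℓ₁ ℓ₂ = (i : Fin 3) → (μ : ℤ³) → InH (Target r i) μ → (u : ℤ³) → InT (k - ι i) u →
  Σ ℤ² λ p → InR ℓ₁ ℓ₂ p × apply (ψ μ) ⟦ u ⟧³ ≡ ⟦ p ⟧²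

ImagesCover : ℕ → (ℤ³ → Affine) → ℤ → ℤ → ℤ → Set
ImagesCover r ψ k ℓ₁ ℓ₂ = (p : ℤ²) → InR ℓ₁ ℓ₂ p →
  Σ (Fin 3) λ i → Σ ℤ³ λ μ → InH (Target r i) μ × Σ ℤ³ λ u → InT (k - ι i) u × apply (ψ μ) ⟦ u ⟧³ ≡ ⟦ p ⟧²

[k+δ]-[δ+i]≡k-i : ∀ k δ i → (k + δ) - (δ + i) ≡ k - i
[k+δ]-[δ+i]≡k-i = solve-∀

module LayoutTiling {r} (L : Layout) (valid : Valid r L) where
  open Layout L
  open Valid valid
  open Stack shape

  slot-of : ℤ³ → Slot
  slot-of = decode label

  ψ : ℤ³ → Affine
  ψ μ = slot-map (slot-of μ)

  classify : ∀ i μ → InH (Target r i) μ → point (label (slot-of μ)) ≡ μ × level (slot-of μ) ≡ i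
  classify i μ (μ∈F₃ , sum) =
    trans (cong (point ∘ label ∘ slot-of) μ≡) (trans (cong point label≡) (sym μ≡)) ,
    trans (cong (level ∘ slot-of) μ≡) level≡
    where
    t = proj₁ (InF₃⇒point μ μ∈F₃)
    μ≡ = proj₂ (InF₃⇒point μ μ∈F₃)
    decoded = label-decode t i (subst (λ ν → coordSum ν ≡ Target r i) μ≡ sum)
    label≡ = proj₁ decoded
    level≡ = proj₂ decoded

  layer≡ : ∀ k s → (k + shift) - κ s ≡ k - ι (level s)
  layer≡ k s = trans (cong (λ κₛ → (k + shift) - κₛ) (κ-level s)) ([k+δ]-[δ+i]≡k-i k shift (ι (level s)))

  to-slot-layer : ∀ k i μ {u} → InH (Target r i) μ → InT (k - ι i) u → InT ((k + shift) - κ (slot-of μ)) u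
  to-slot-layer k i μ {u} μ∈H = subst (λ t → InT t u)
    (sym (trans (layer≡ k (slot-of μ)) (cong (λ j → k - ι j) (proj₂ (classify i μ μ∈H)))))

  -- Each slot map is injective on every T_s, so the hypothesis s ≥ 1 is not needed.
  injective : InjectiveOnLayers r ψ
  injective s _ _ μ _ _ _ = slot-map-injective s (slot-of μ)

  disjoint : ∀ k → DisjointImages r ψ k
  disjoint k i i′ μ μ′ μ∈H μ′∈H u u′ u∈T u′∈T eq =
    trans (sym (proj₂ (classify i μ μ∈H))) (trans (cong level same-slot) (proj₂ (classify i′ μ′ μ′∈H))) ,
    trans (sym (proj₁ (classify i μ μ∈H))) (trans (cong (point ∘ label) same-slot) (proj₁ (classify i′ μ′ μ′∈H)))
    where
    h = k + shift
    v∈T = to-slot-layer k i μ μ∈H u∈T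
    v′∈T = to-slot-layer k i′ μ′ μ′∈H u′∈T
    same-slot : slot-of μ ≡ slot-of μ′
    same-slot = place-slot-unique h (slot-of μ) (slot-of μ′) u u′ v∈T v′∈T (⟦⟧²-injective
      (trans (sym (slot-map-agrees h (slot-of μ) u v∈T)) (trans eq (slot-map-agrees h (slot-of μ′) u′ v′∈T))))

  inside : ∀ k → ImagesInside r ψ k (k + shift) (length (k + shift))
  inside k i μ μ∈H u u∈T =
    place (k + shift) (slot-of μ) u , place∈rectangle (k + shift) (slot-of μ) u v∈T ,
    slot-map-agrees (k + shift) (slot-of μ) u v∈T
    where v∈T = to-slot-layer k i μ μ∈H u∈T

  cover : ∀ k → ImagesCover r ψ k (k + shift) (length (k + shift))
  cover k p p∈R with place-cover (k + shift) p p∈R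
  ... | s , u , u∈T , place≡ =
    level s , point (label s) , (point-InF₃ (label s) , label-sum s) , u ,
    subst (λ t → InT t u) (layer≡ k s) u∈T ,
    trans (cong (λ s′ → apply (slot-map s′) ⟦ u ⟧³) (decode-label s))
          (trans (slot-map-agrees (k + shift) s u u∈T) (cong ⟦_⟧² place≡))

blocks : {A : Set} → A → A → A → Fin 3 → A
blocks a _ _ zero = a
blocks _ a _ (suc zero) = a
blocks _ _ a (suc (suc zero)) = a

table : {A : Set} → A → A → A → A → A → A → Slot → A
table a _ _ _ _ _ (zero , below) = a
table _ a _ _ _ _ (zero , above) = a
table _ _ a _ _ _ (suc zero , below) = a
table _ _ _ a _ _ (suc zero , above) = a
table _ _ _ _ a _ (suc (suc zero) , below) = a
table _ _ _ _ _ a (suc (suc zero) , above) = a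

-- One layout for each residue r ∈ {0, 1, 2, 4, 5} that occurs; the labels were found by a
-- finite search and are certified by evaluating valid?.
layout₀ layout₁ layout₂ layout₄ layout₅ : Layout
layout₀ = record
  { shape = blocks square square square ; shift = + 0
  ; level = table (# 1) (# 2) (# 1) (# 2) (# 1) (# 2)
  ; label = table (# 0 , # 0 , # 1) (# 2 , # 2 , # 1) (# 1 , # 1 , # 0)
                  (# 4 , # 1 , # 1) (# 3 , # 0 , # 0) (# 5 , # 2 , # 0) }
layout₁ = record
  { shape = blocks square square wide ; shift = + 0
  ; level = table (# 1) (# 2) (# 1) (# 2) (# 1) (# 1)
  ; label = table (# 0 , # 2 , # 0) (# 3 , # 2 , # 1) (# 1 , # 0 , # 1)
                  (# 5 , # 1 , # 1) (# 2 , # 1 , # 0) (# 4 , # 0 , # 0) }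
layout₂ = record
  { shape = blocks square wide wide ; shift = + 0
  ; level = table (# 1) (# 2) (# 1) (# 1) (# 1) (# 1)
  ; label = table (# 0 , # 1 , # 1) (# 4 , # 2 , # 1) (# 1 , # 2 , # 0)
                  (# 2 , # 0 , # 1) (# 3 , # 1 , # 0) (# 5 , # 0 , # 0) }
layout₄ = record
  { shape = blocks square narrow narrow ; shift = + 1
  ; level = table (# 0) (# 1) (# 1) (# 1) (# 1) (# 1)
  ; label = table (# 1 , # 0 , # 0) (# 0 , # 2 , # 1) (# 2 , # 1 , # 1)
                  (# 3 , # 2 , # 0) (# 4 , # 0 , # 1) (# 5 , # 1 , # 0) }
layout₅ = record
  { shape = blocks square square narrow ; shift = + 1
  ; level = table (# 0) (# 1) (# 0) (# 1) (# 1) (# 1)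
  ; label = table (# 0 , # 1 , # 0) (# 1 , # 2 , # 1) (# 2 , # 0 , # 0)
                  (# 3 , # 1 , # 1) (# 4 , # 2 , # 0) (# 5 , # 0 , # 1) }

valid₀ : Valid 0 layout₀
valid₀ = toWitness {a? = valid? 0 layout₀} tt

valid₁ : Valid 1 layout₁
valid₁ = toWitness {a? = valid? 1 layout₁} tt

valid₂ : Valid 2 layout₂
valid₂ = toWitness {a? = valid? 2 layout₂} tt

valid₄ : Valid 4 layout₄
valid₄ = toWitness {a? = valid? 4 layout₄} tt

valid₅ : Valid 5 layout₅
valid₅ = toWitness {a? = valid? 5 layout₅} tt

-- The nine values of r′

Tiling : ℤ → ℤ → Set
Tiling M r′ =
  Σ ℕ λ r → r ℕ.< 6 ×
  Σ (ℤ → ℤ) λ k → Σ (ℤ → ℤ) λ ℓ₁ → Σ (ℤ → ℤ) λ ℓ₂ →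
  ((k′ : ℕ) → + 6 * M * + k′ + r′ ≡ + 6 * k (+ k′) + + r) ×
  Σ (ℤ³ → Affine) λ ψ → InjectiveOnLayers r ψ ×
  ((k′ : ℕ) → DisjointImages r ψ (k (+ k′)) × ImagesInside r ψ (k (+ k′)) (ℓ₁ (+ k′)) (ℓ₂ (+ k′)) ×
              ImagesCover r ψ (k (+ k′)) (ℓ₁ (+ k′)) (ℓ₂ (+ k′))) ×
  (((k′ : ℕ) → M ∣ ℓ₁ (+ k′)) ⊎ ((k′ : ℕ) → M ∣ ℓ₂ (+ k′)))

-- With k(k′) = M k′ + q one has ℓ₁ = M k′ + (q + shift) and ℓ₂ = 3 M k′ + 3 (q + shift) + Σ ε.
tiling : ∀ M r′ {r} (L : Layout) → Valid r L → (q : ℤ) → r′ ≡ + 6 * q + + r →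
  let open Layout L in
  M Signed.∣ q + shift ⊎ M Signed.∣ + 3 * (q + shift) + Stack.total-excess shape → Tiling M r′
tiling M _ {r} L valid q refl M∣ =
  r , r<6 , k , (λ K → k K + shift) , (λ K → length (k K + shift)) ,
  (λ k′ → regroup-r′ M (+ k′) q (+ r)) ,
  ψ , injective , (λ k′ → disjoint (k (+ k′)) , inside (k (+ k′)) , cover (k (+ k′))) ,
  Sum.map (λ M∣ k′ → ∣⇒∣ᵤ (M∣ℓ₁ (+ k′) M∣)) (λ M∣ k′ → ∣⇒∣ᵤ (M∣ℓ₂ (+ k′) M∣)) M∣
  where
  open Layout L
  open Valid valid
  open Stack shape
  open LayoutTiling L valid
  k : ℤ → ℤ
  k K = M * K + q
  regroup-r′ : ∀ M K q c → + 6 * M * K + (+ 6 * q + c) ≡ + 6 * (M * K + q) + c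
  regroup-r′ = solve-∀
  regroup-ℓ₂ : ∀ M K q δ T → + 3 * ((M * K + q) + δ) + T ≡ M * (+ 3 * K) + (+ 3 * (q + δ) + T)
  regroup-ℓ₂ = solve-∀
  M∣ℓ₁ : ∀ K → M Signed.∣ q + shift → M Signed.∣ k K + shift
  M∣ℓ₁ K M∣ = subst (M Signed.∣_) (sym (ℤP.+-assoc (M * K) q shift)) (∣m∣n⇒∣m+n (∣m⇒∣m*n K ∣-refl) M∣)
  M∣ℓ₂ : ∀ K → M Signed.∣ + 3 * (q + shift) + total-excess → M Signed.∣ length (k K + shift)
  M∣ℓ₂ K M∣ = subst (M Signed.∣_) (sym (trans (length-linear (k K + shift)) (regroup-ℓ₂ M K q shift total-excess)))
    (∣m∣n⇒∣m+n (∣m⇒∣m*n (+ 3 * K) ∣-refl) M∣)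

∣0 : ∀ M → M Signed.∣ + 0
∣0 M = divides (+ 0) (sym (ℤP.*-zeroˡ M))

m≡6j-1 : ∀ j → 1 ℕ.≤ j → + (6 ℕ.* j ℕ.∸ 1) ≡ + 6 * + j - + 1
m≡6j-1 j 1≤j = sym (begin
  + 6 * + j - + 1     ≡⟨ cong (_- + 1) (sym (ℤP.pos-* 6 j)) ⟩
  + (6 ℕ.* j) - + 1   ≡⟨ ℤP.m-n≡m⊖n (6 ℕ.* j) 1 ⟩
  (6 ℕ.* j) ℤ.⊖ 1     ≡⟨ ℤP.⊖-≥ (ℕP.≤-trans 1≤j (ℕP.m≤n*m j 6)) ⟩
  + (6 ℕ.* j ℕ.∸ 1)   ∎)
  where open ≡-Reasoning

tiling-[2m-2] : ∀ J {M} → M ≡ + 6 * J - + 1 → Tiling M (+ 2 * M - + 2)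
tiling-[2m-2] J refl = tiling _ _ layout₂ valid₂ (+ 2 * J - + 1) (residue J) (inj₂ (divides (+ 1) (ℓ₂-part J)))
  where
  residue : ∀ J → + 2 * (+ 6 * J - + 1) - + 2 ≡ + 6 * (+ 2 * J - + 1) + + 2
  residue = solve-∀
  ℓ₂-part : ∀ J → + 3 * ((+ 2 * J - + 1) + + 0) + ((+ 0 + + 1) + + 1) ≡ + 1 * (+ 6 * J - + 1)
  ℓ₂-part = solve-∀

tiling-[-2m+2] : ∀ J {M} → M ≡ + 6 * J - + 1 → Tiling M (- (+ 2 * M - + 2))
tiling-[-2m+2] J refl = tiling _ _ layout₄ valid₄ (- (+ 2 * J)) (residue J) (inj₂ (divides (- + 1) (ℓ₂-part J)))
  where
  residue : ∀ J → - (+ 2 * (+ 6 * J - + 1) - + 2) ≡ + 6 * - (+ 2 * J) + + 4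
  residue = solve-∀
  ℓ₂-part : ∀ J → + 3 * (- (+ 2 * J) + + 1) + ((+ 0 + - + 1) + - + 1) ≡ - + 1 * (+ 6 * J - + 1)
  ℓ₂-part = solve-∀

tiling-[2m+1] : ∀ J {M} → M ≡ + 6 * J - + 1 → Tiling M (+ 2 * M + + 1)
tiling-[2m+1] J refl = tiling _ _ layout₅ valid₅ (+ 2 * J - + 1) (residue J) (inj₂ (divides (+ 1) (ℓ₂-part J)))
  where
  residue : ∀ J → + 2 * (+ 6 * J - + 1) + + 1 ≡ + 6 * (+ 2 * J - + 1) + + 5
  residue = solve-∀
  ℓ₂-part : ∀ J → + 3 * ((+ 2 * J - + 1) + + 1) + ((+ 0 + + 0) + - + 1) ≡ + 1 * (+ 6 * J - + 1)
  ℓ₂-part = solve-∀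

tiling-[-2m-1] : ∀ J {M} → M ≡ + 6 * J - + 1 → Tiling M (- (+ 2 * M + + 1))
tiling-[-2m-1] J refl = tiling _ _ layout₁ valid₁ (- (+ 2 * J)) (residue J) (inj₂ (divides (- + 1) (ℓ₂-part J)))
  where
  residue : ∀ J → - (+ 2 * (+ 6 * J - + 1) + + 1) ≡ + 6 * - (+ 2 * J) + + 1
  residue = solve-∀
  ℓ₂-part : ∀ J → + 3 * (- (+ 2 * J) + + 0) + ((+ 0 + + 0) + + 1) ≡ - + 1 * (+ 6 * J - + 1)
  ℓ₂-part = solve-∀

lemma2 : (j : ℕ) → 1 ℕ.≤ j → Prime (6 ℕ.* j ℕ.∸ 1) →
    let m = 6 ℕ.* j ℕ.∸ 1 in
    (r′ : ℤ) → r′ ∈ admissible-r′ m →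
    Σ ℕ λ r → r ℕ.< 6 ×
    Σ (ℤ → ℤ) λ k → Σ (ℤ → ℤ) λ ℓ₁ → Σ (ℤ → ℤ) λ ℓ₂ →
    ((k′ : ℕ) → + 6 ℤ.* + m ℤ.* + k′ ℤ.+ r′ ≡ + 6 ℤ.* k (+ k′) ℤ.+ + r) ×
    Σ (ℤ³ → Affine) λ ψ →
      ((s : ℤ) → + 1 ℤ.≤ s → (i : Fin 3) → (μ : ℤ³) → InH (+ r ℤ.+ + 6 ℤ.* ι i) μ →
        (u v : ℤ³) → InT s u → InT s v →
        apply (ψ μ) ⟦ u ⟧³ ≡ apply (ψ μ) ⟦ v ⟧³ → u ≡ v) ×
      ((k′ : ℕ) →
        ((i i′ : Fin 3) → (μ μ′ : ℤ³) →
          InH (+ r ℤ.+ + 6 ℤ.* ι i) μ → InH (+ r ℤ.+ + 6 ℤ.* ι i′) μ′ →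
          (u u′ : ℤ³) → InT (k (+ k′) ℤ.- ι i) u → InT (k (+ k′) ℤ.- ι i′) u′ →
          apply (ψ μ) ⟦ u ⟧³ ≡ apply (ψ μ′) ⟦ u′ ⟧³ → i ≡ i′ × μ ≡ μ′) ×
        ((i : Fin 3) → (μ : ℤ³) → InH (+ r ℤ.+ + 6 ℤ.* ι i) μ →
          (u : ℤ³) → InT (k (+ k′) ℤ.- ι i) u →
          Σ ℤ² λ p → InR (ℓ₁ (+ k′)) (ℓ₂ (+ k′)) p × apply (ψ μ) ⟦ u ⟧³ ≡ ⟦ p ⟧²) ×
        ((p : ℤ²) → InR (ℓ₁ (+ k′)) (ℓ₂ (+ k′)) p →
          Σ (Fin 3) λ i → Σ ℤ³ λ μ → InH (+ r ℤ.+ + 6 ℤ.* ι i) μ ×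
          Σ ℤ³ λ u → InT (k (+ k′) ℤ.- ι i) u × apply (ψ μ) ⟦ u ⟧³ ≡ ⟦ p ⟧²)) ×
      (((k′ : ℕ) → + m ∣ ℓ₁ (+ k′)) ⊎ ((k′ : ℕ) → + m ∣ ℓ₂ (+ k′)))
lemma2 j _ _ _ (here refl) = tiling (+ _) _ layout₀ valid₀ (+ 0) refl (inj₁ (∣0 _))
lemma2 j _ _ _ (there (here refl)) = tiling (+ _) _ layout₁ valid₁ (+ 0) refl (inj₁ (∣0 _))
lemma2 j _ _ _ (there (there (here refl))) = tiling (+ _) _ layout₅ valid₅ (- + 1) refl (inj₁ (∣0 _))
lemma2 j _ _ _ (there (there (there (here refl)))) = tiling (+ _) _ layout₂ valid₂ (+ 0) refl (inj₁ (∣0 _))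
lemma2 j _ _ _ (there (there (there (there (here refl))))) = tiling (+ _) _ layout₄ valid₄ (- + 1) refl (inj₁ (∣0 _))
lemma2 j 1≤j _ _ (there (there (there (there (there (here refl)))))) = tiling-[2m-2] (+ j) (m≡6j-1 j 1≤j)
lemma2 j 1≤j _ _ (there (there (there (there (there (there (here refl))))))) = tiling-[-2m+2] (+ j) (m≡6j-1 j 1≤j)
lemma2 j 1≤j _ _ (there (there (there (there (there (there (there (here refl)))))))) = tiling-[2m+1] (+ j) (m≡6j-1 j 1≤j)
lemma2 j 1≤j _ _ (there (there (there (there (there (there (there (there (here refl))))))))) =
  tiling-[-2m-1] (+ j) (m≡6j-1 j 1≤j)
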